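{- Let $x$ be a binary word and let $J$ be any one of $J_{\mathrm{rect}}$, $J_{\mathrm{tri}}$, $J_{\mathrm{hex}}$. Then $J(x1)\le J(x)$ and $J(1x)\le J(x)$.
   Context: Words are finite strings over $\{0,1\}$ ($0$ = hydrophobic, $1$ = polar); $x1$ and $1x$ denote appending/prepending the letter $1$. Consider three lattice graphs: the 2D rectangular lattice $\mathbb Z^2$ (nearest neighbours), the triangular lattice (vertices and edges of the regular triangular tiling of the plane, 6-regular), and the hexagonal lattice (vertices and edges of the regular hexagonal tiling, 3-regular). A fold of a word $w=w_1\cdots w_n$ in a lattice is a self-avoiding walk $v_1,\dots,v_n$ (distinct vertices, $v_i$ adjacent to $v_{i+1}$); its score is the number of pairs $\{i,j\}$ with $|i-j|\ge 2$, $w_i=w_j=0$ and $v_i,v_j$ adjacent in the lattice. $J_{\mathrm{rect}}(w)$, $J_{\mathrm{tri}}(w)$, $J_{\mathrm{hex}}(w)$ denote the maximum score over all folds of $w$ in the rectangular, triangular and hexagonal lattice respectively. -}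

module Defs where

open import Data.Bool using (Bool; true; false; if_then_else_)
open import Data.Nat using (ℕ; zero; suc; _+_; _≤_; _%_; _≡ᵇ_)
open import Data.Integer as ℤ using (ℤ; +_; -[1+_]; ∣_∣)
open import Data.Fin using (Fin; toℕ)
open import Data.Nat.ListAction using (sum)
open import Data.List using (List; []; _∷_; length; lookup; map; allFin; [_]) renaming (_++_ to _++ₗ_)
open import Data.Product using (_×_; _,_; Σ; ∃)
open import Data.Product.Properties using (≡-dec)
open import Data.List.Membership.Propositional using (_∈_)
import Data.List.Membership.DecPropositional as DecMem
open import Relation.Binary.PropositionalEquality using (_≡_)
open import Relation.Nullary using (Dec; yes; no; does; _×-dec_)
open import Function.Definitions using (Injective)

-- Letters: 𝟘 = hydrophobic (0), 𝟙 = polar (1)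
data Letter : Set where
  𝟘 𝟙 : Letter

Word : Set
Word = List Letter

_·1 : Word → Word
x ·1 = x ++ₗ [ 𝟙 ]

Point : Set
Point = ℤ × ℤ

_≟P_ : (p q : Point) → Dec (p ≡ q)
_≟P_ = ≡-dec ℤ._≟_ ℤ._≟_

data Lattice : Set where
  rect tri hex : Lattice

-- Neighbour offsets of a vertex p.
--  rect : Z^2 with the four unit steps.
--  tri  : triangular lattice in axial coordinates (Z^2 plus the diagonal (1,-1)).
--  hex  : hexagonal (honeycomb) lattice in the "brick wall" embedding:
--         horizontal steps always, vertical step up if x+y even, down if x+y odd.
offsets : Lattice → Point → List Point
offsets rect _ = (+ 1 , + 0) ∷ (-[1+ 0 ] , + 0) ∷ (+ 0 , + 1) ∷ (+ 0 , -[1+ 0 ]) ∷ []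
offsets tri  _ = (+ 1 , + 0) ∷ (-[1+ 0 ] , + 0) ∷ (+ 0 , + 1) ∷ (+ 0 , -[1+ 0 ])
               ∷ (+ 1 , -[1+ 0 ]) ∷ (-[1+ 0 ] , + 1) ∷ []
offsets hex (x , y) =
  (+ 1 , + 0) ∷ (-[1+ 0 ] , + 0)
  ∷ (if (∣ x ℤ.+ y ∣ % 2) ≡ᵇ 0 then (+ 0 , + 1) else (+ 0 , -[1+ 0 ])) ∷ []

diff : Point → Point → Point
diff (a , b) (c , d) = (c ℤ.- a , d ℤ.- b)

Adjacent : Lattice → Point → Point → Set
Adjacent L p q = diff p q ∈ offsets L p

adjacent? : (L : Lattice) (p q : Point) → Dec (Adjacent L p q)
adjacent? L p q = DecMem._∈?_ _≟P_ (diff p q) (offsets L p)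

letter≟ : (a b : Letter) → Dec (a ≡ b)
letter≟ 𝟘 𝟘 = yes _≡_.refl
letter≟ 𝟘 𝟙 = no (λ ())
letter≟ 𝟙 𝟘 = no (λ ())
letter≟ 𝟙 𝟙 = yes _≡_.refl

record Fold (L : Lattice) (w : Word) : Set where
  field
    pos      : Fin (length w) → Point
    injective : Injective _≡_ _≡_ pos
    walk     : (i j : Fin (length w)) → suc (toℕ i) ≡ toℕ j → Adjacent L (pos i) (pos j)
open Fold public

indicator : ∀ {P : Set} → Dec P → ℕ
indicator d = if does d then 1 else 0

contact : (L : Lattice) (w : Word) (f : Fold L w) → Fin (length w) → Fin (length w) → ℕ
contact L w f i j =
  indicator ((toℕ i + 2 Data.Nat.≤? toℕ j)
             ×-dec (letter≟ (lookup w i) 𝟘)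
             ×-dec (letter≟ (lookup w j) 𝟘)
             ×-dec adjacent? L (pos f i) (pos f j))

score : (L : Lattice) (w : Word) → Fold L w → ℕ
score L w f = sum (map (λ i → sum (map (λ j → contact L w f i j) (allFin (length w))))
                       (allFin (length w)))

IsJ : Lattice → Word → ℕ → Set
IsJ L w m = (Σ (Fold L w) λ f → score L w f ≡ m) × ((f : Fold L w) → score L w f ≤ m)

{-# OPTIONS --safe #-}
-- A polar letter is never in a contact, so the contacts of a fold of x1 (resp. 1x) are exactly
-- those of the fold of x obtained by forgetting its last (resp. first) vertex. Every fold of
-- x1 or 1x therefore has the score of some fold of x.
module Submission where

open import Defs
open import Data.Bool using (if_then_else_)
open import Data.Fin using (Fin; toℕ; zero; suc)
open import Data.Fin.Properties using (toℕ-injective)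
open import Data.List using (List; []; _∷_; _∷ʳ_; length; lookup; map; tabulate; allFin)
open import Data.List.Properties using (map-tabulate)
open import Data.Nat using (ℕ; zero; suc; _+_; _≤_; _≤?_)
open import Data.Nat.ListAction using (sum)
open import Data.Nat.Properties
  using (+-0-monoid; +-comm; +-assoc; +-suc; +-cancelˡ-≡; +-cancelˡ-≤; +-monoʳ-≤)
open import Data.Product using (_×_; _,_)
open import Function using (_∘_; id; _⇔_; mk⇔; Equivalence)
open import Relation.Binary.PropositionalEquality
open import Relation.Nullary using (¬_; Dec; _×-dec_)
open import Relation.Nullary.Decidable using (does-⇔; dec-false)

open import Algebra.Properties.Monoid.Sum +-0-monoid
  using (sum-cong-≗; sum-replicate-zero) renaming (sum to ∑)

open ≡-Reasoning

sum-tabulate : ∀ {n} (t : Fin n → ℕ) → sum (tabulate t) ≡ ∑ t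
sum-tabulate {zero}  t = refl
sum-tabulate {suc n} t = cong (t zero +_) (sum-tabulate (t ∘ suc))

sum-map-allFin : ∀ {n} (t : Fin n → ℕ) → sum (map t (allFin n)) ≡ ∑ t
sum-map-allFin t = trans (cong sum (map-tabulate id t)) (sum-tabulate t)

∑-zero : ∀ {n} {t : Fin n → ℕ} → (∀ i → t i ≡ 0) → ∑ t ≡ 0
∑-zero {n} t≗0 = trans (sum-cong-≗ t≗0) (sum-replicate-zero n)

-- Fin n is the disjoint union of the image of ι and {p}, expressed through sums.
Splits : ∀ {m n} → (Fin m → Fin n) → Fin n → Set
Splits ι p = ∀ t → ∑ t ≡ ∑ (t ∘ ι) + t p

∑∑-drop : ∀ {m n} {ι : Fin m → Fin n} {p : Fin n} → Splits ι p →
          (G : Fin n → Fin n → ℕ) → (∀ j → G p j ≡ 0) → (∀ i → G i p ≡ 0) →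
          ∑ (λ i → ∑ (G i)) ≡ ∑ (λ i → ∑ (λ j → G (ι i) (ι j)))
∑∑-drop {ι = ι} {p} split G row≡0 col≡0 = begin
  ∑ (λ i → ∑ (G i))                                 ≡⟨ sum-cong-≗ drop-column ⟩
  ∑ (λ i → ∑ (G i ∘ ι))                             ≡⟨ split _ ⟩
  ∑ (λ i → ∑ (G (ι i) ∘ ι)) + ∑ (G p ∘ ι)           ≡⟨ cong (_ +_) (∑-zero (row≡0 ∘ ι)) ⟩
  ∑ (λ i → ∑ (G (ι i) ∘ ι)) + 0                     ≡⟨ +-comm _ 0 ⟩
  ∑ (λ i → ∑ (G (ι i) ∘ ι))                         ∎
  where
  drop-column : ∀ i → ∑ (G i) ≡ ∑ (G i ∘ ι)
  drop-column i = trans (split (G i)) (trans (cong (∑ (G i ∘ ι) +_) (col≡0 i)) (+-comm _ 0))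

suc-splits : ∀ {n} → Splits {n} suc zero
suc-splits t = +-comm (t zero) _

module _ {a} {A : Set a} where

  inject∷ʳ : (xs : List A) (y : A) → Fin (length xs) → Fin (length (xs ∷ʳ y))
  inject∷ʳ (_ ∷ xs) y zero    = zero
  inject∷ʳ (_ ∷ xs) y (suc i) = suc (inject∷ʳ xs y i)

  last∷ʳ : (xs : List A) (y : A) → Fin (length (xs ∷ʳ y))
  last∷ʳ []       y = zero
  last∷ʳ (_ ∷ xs) y = suc (last∷ʳ xs y)

  toℕ-inject∷ʳ : ∀ xs y i → toℕ (inject∷ʳ xs y i) ≡ toℕ i
  toℕ-inject∷ʳ (_ ∷ xs) y zero    = refl
  toℕ-inject∷ʳ (_ ∷ xs) y (suc i) = cong suc (toℕ-inject∷ʳ xs y i)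

  lookup-inject∷ʳ : ∀ xs y i → lookup (xs ∷ʳ y) (inject∷ʳ xs y i) ≡ lookup xs i
  lookup-inject∷ʳ (_ ∷ xs) y zero    = refl
  lookup-inject∷ʳ (_ ∷ xs) y (suc i) = lookup-inject∷ʳ xs y i

  lookup-last∷ʳ : ∀ xs y → lookup (xs ∷ʳ y) (last∷ʳ xs y) ≡ y
  lookup-last∷ʳ []       y = refl
  lookup-last∷ʳ (_ ∷ xs) y = lookup-last∷ʳ xs y

  inject∷ʳ-splits : ∀ xs y → Splits (inject∷ʳ xs y) (last∷ʳ xs y)
  inject∷ʳ-splits []       y t = +-comm (t zero) 0
  inject∷ʳ-splits (_ ∷ xs) y t = begin
    t zero + ∑ (t ∘ suc)                                  ≡⟨ cong (t zero +_) (inject∷ʳ-splits xs y (t ∘ suc)) ⟩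
    t zero + (∑ (t ∘ suc ∘ inject∷ʳ xs y) + t (suc last))  ≡⟨ +-assoc (t zero) _ _ ⟨
    t zero + ∑ (t ∘ suc ∘ inject∷ʳ xs y) + t (suc last)    ∎
    where last = last∷ʳ xs y

-- x sits in w as a block of consecutive positions (so walks restrict to walks), and the one
-- remaining position of w carries 𝟙.
record PolarExtension (w x : Word) : Set where
  field
    embed        : Fin (length x) → Fin (length w)
    offset       : ℕ
    toℕ-embed    : ∀ i → toℕ (embed i) ≡ offset + toℕ i
    extra        : Fin (length w)
    splits       : Splits embed extra
    lookup-embed : ∀ i → lookup w (embed i) ≡ lookup x i
    lookup-extra : lookup w extra ≡ 𝟙

  embed-injective : ∀ {i j} → embed i ≡ embed j → i ≡ j
  embed-injective {i} {j} eq = toℕ-injective (+-cancelˡ-≡ offset _ _ (begin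
    offset + toℕ i   ≡⟨ toℕ-embed i ⟨
    toℕ (embed i)    ≡⟨ cong toℕ eq ⟩
    toℕ (embed j)    ≡⟨ toℕ-embed j ⟩
    offset + toℕ j   ∎))

  embed-suc : ∀ {i j} → suc (toℕ i) ≡ toℕ j → suc (toℕ (embed i)) ≡ toℕ (embed j)
  embed-suc {i} {j} eq = begin
    suc (toℕ (embed i))    ≡⟨ cong suc (toℕ-embed i) ⟩
    suc (offset + toℕ i)   ≡⟨ +-suc offset (toℕ i) ⟨
    offset + suc (toℕ i)   ≡⟨ cong (offset +_) eq ⟩
    offset + toℕ j         ≡⟨ toℕ-embed j ⟨
    toℕ (embed j)          ∎

  embed-gap : ∀ {i j} → toℕ i + 2 ≤ toℕ j ⇔ toℕ (embed i) + 2 ≤ toℕ (embed j)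
  embed-gap {i} {j} = mk⇔
    (λ gap → subst₂ _≤_ (shifted i) (sym (toℕ-embed j)) (+-monoʳ-≤ offset gap))
    (λ gap → +-cancelˡ-≤ offset _ _ (subst₂ _≤_ (sym (shifted i)) (toℕ-embed j) gap))
    where
    shifted : ∀ i → offset + (toℕ i + 2) ≡ toℕ (embed i) + 2
    shifted i = trans (sym (+-assoc offset (toℕ i) 2)) (cong (_+ 2) (sym (toℕ-embed i)))

restrict : ∀ {L w x} → PolarExtension w x → Fold L w → Fold L x
restrict e f = record
  { pos       = pos f ∘ embed
  ; injective = embed-injective ∘ injective f
  ; walk      = λ i j i+1≡j → walk f (embed i) (embed j) (embed-suc i+1≡j)
  }
  where open PolarExtension e

Contact : (L : Lattice) (w : Word) → Fold L w → Fin (length w) → Fin (length w) → Set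
Contact L w f i j =
  toℕ i + 2 ≤ toℕ j × lookup w i ≡ 𝟘 × lookup w j ≡ 𝟘 × Adjacent L (pos f i) (pos f j)

contact? : ∀ L w f i j → Dec (Contact L w f i j)
contact? L w f i j = (toℕ i + 2 ≤? toℕ j) ×-dec letter≟ (lookup w i) 𝟘 ×-dec letter≟ (lookup w j) 𝟘
                     ×-dec adjacent? L (pos f i) (pos f j)

indicator-⇔ : ∀ {P Q : Set} (p? : Dec P) (q? : Dec Q) → P ⇔ Q → indicator p? ≡ indicator q?
indicator-⇔ p? q? P⇔Q = cong (if_then 1 else 0) (does-⇔ P⇔Q p? q?)

indicator-≡0 : ∀ {P : Set} (p? : Dec P) → ¬ P → indicator p? ≡ 0
indicator-≡0 p? ¬p = cong (if_then 1 else 0) (dec-false p? ¬p)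

score-∑∑ : ∀ L w f → score L w f ≡ ∑ (λ i → ∑ (contact L w f i))
score-∑∑ L w f = trans (sum-map-allFin row) (sum-cong-≗ (sum-map-allFin ∘ contact L w f))
  where
  row : Fin (length w) → ℕ
  row i = sum (map (contact L w f i) (allFin (length w)))

𝟙≢𝟘 : 𝟙 ≢ 𝟘
𝟙≢𝟘 ()

score-restrict : ∀ {L w x} (e : PolarExtension w x) (f : Fold L w) →
                 score L w f ≡ score L x (restrict e f)
score-restrict {L} {w} {x} e f = begin
  score L w f                                            ≡⟨ score-∑∑ L w f ⟩
  ∑ (λ i → ∑ (contact L w f i))                          ≡⟨ ∑∑-drop {ι = embed} {extra} splits
                                                              (contact L w f) row≡0 column≡0 ⟩
  ∑ (λ i → ∑ (λ j → contact L w f (embed i) (embed j))) ≡⟨ sum-cong-≗ (sum-cong-≗ ∘ contact-embed) ⟩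
  ∑ (λ i → ∑ (contact L x (restrict e f) i))             ≡⟨ score-∑∑ L x (restrict e f) ⟨
  score L x (restrict e f)                               ∎
  where
  open PolarExtension e

  polar : ¬ lookup w extra ≡ 𝟘
  polar 𝟘ₑ = 𝟙≢𝟘 (trans (sym lookup-extra) 𝟘ₑ)

  row≡0 : ∀ j → contact L w f extra j ≡ 0
  row≡0 j = indicator-≡0 (contact? L w f extra j) (λ (_ , 𝟘ₑ , _) → polar 𝟘ₑ)

  column≡0 : ∀ i → contact L w f i extra ≡ 0
  column≡0 i = indicator-≡0 (contact? L w f i extra) (λ (_ , _ , 𝟘ₑ , _) → polar 𝟘ₑ)

  contact-embed : ∀ i j → contact L w f (embed i) (embed j) ≡ contact L x (restrict e f) i j
  contact-embed i j = indicator-⇔ (contact? L w f (embed i) (embed j)) (contact? L x (restrict e f) i j)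
    (mk⇔ (λ (gap , 𝟘ᵢ , 𝟘ⱼ , adj) → Equivalence.from embed-gap gap
                                  , trans (sym (lookup-embed i)) 𝟘ᵢ , trans (sym (lookup-embed j)) 𝟘ⱼ , adj)
         (λ (gap , 𝟘ᵢ , 𝟘ⱼ , adj) → Equivalence.to embed-gap gap
                                  , trans (lookup-embed i) 𝟘ᵢ , trans (lookup-embed j) 𝟘ⱼ , adj))

IsJ-polarExtension-≤ : ∀ {L w x m n} → PolarExtension w x → IsJ L x m → IsJ L w n → n ≤ m
IsJ-polarExtension-≤ e (_ , bound) ((f , score≡n) , _) =
  subst (_≤ _) (trans (sym (score-restrict e f)) score≡n) (bound (restrict e f))

∷-polarExtension : ∀ x → PolarExtension (𝟙 ∷ x) x
∷-polarExtension x = record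
  { embed        = suc
  ; offset       = 1
  ; toℕ-embed    = λ _ → refl
  ; extra        = zero
  ; splits       = suc-splits
  ; lookup-embed = λ _ → refl
  ; lookup-extra = refl
  }

∷ʳ-polarExtension : ∀ x → PolarExtension (x ∷ʳ 𝟙) x
∷ʳ-polarExtension x = record
  { embed        = inject∷ʳ x 𝟙
  ; offset       = 0
  ; toℕ-embed    = toℕ-inject∷ʳ x 𝟙
  ; extra        = last∷ʳ x 𝟙
  ; splits       = inject∷ʳ-splits x 𝟙
  ; lookup-embed = lookup-inject∷ʳ x 𝟙
  ; lookup-extra = lookup-last∷ʳ x 𝟙
  }

theorem2p11 : (L : Lattice) (x : Word) (m m₁ m₂ : ℕ)
    → IsJ L x m → IsJ L (x ·1) m₁ → IsJ L (𝟙 ∷ x) m₂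
    → (m₁ ≤ m) × (m₂ ≤ m)
theorem2p11 L x m m₁ m₂ Jx Jx1 J1x =
  IsJ-polarExtension-≤ (∷ʳ-polarExtension x) Jx Jx1 , IsJ-polarExtension-≤ (∷-polarExtension x) Jx J1x
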